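{- If $H$ is a connected subgraph (with at least two vertices) of a connected graph $G$, then $pd(H)\leq pd(G)$.
   Context: All graphs are simple, finite and undirected. For an edge-coloring $c$ of a graph $G$, a set $F\subseteq E(G)$ is a proper cut if $G-F$ is disconnected and any two edges of $F$ sharing an endpoint receive different colors. A proper cut $F$ separates two vertices $x,y$ if $x$ and $y$ lie in different components of $G-F$. An edge-colored graph is proper disconnected if for every pair of distinct vertices there is a proper cut separating them. For a connected graph $G$, the proper disconnection number $pd(G)$ is the minimum $k$ such that there is an edge-coloring $c:E(G)\to\{1,\dots,k\}$ making $G$ proper disconnected. -}

module Defs where

open import Data.Nat using (ℕ; _≤_)
open import Data.Fin using (Fin)
open import Data.Bool using (Bool; true; false; T)
open import Data.Product using (Σ; ∃; _×_)
open import Relation.Binary.PropositionalEquality using (_≡_; _≢_)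
open import Relation.Nullary using (¬_)
open import Relation.Binary.Construct.Closure.ReflexiveTransitive using (Star)

record Graph (n : ℕ) : Set where
  field
    adj    : Fin n → Fin n → Bool
    sym    : ∀ u v → adj u v ≡ adj v u
    irrefl : ∀ u → adj u u ≡ false

open Graph public

-- u and v are joined by an edge (proof-irrelevant: T b is ⊤ or ⊥)
Edge : ∀ {n} → Graph n → Fin n → Fin n → Set
Edge G u v = T (adj G u v)

Connected : ∀ {n} → Graph n → Set
Connected G = ∀ x y → Star (Edge G) x y

-- an edge-colouring with colours {1..k} (represented by Fin k); the colour
-- of the edge uv does not depend on the orientation
record EdgeColoring {n} (G : Graph n) (k : ℕ) : Set where
  field
    col     : ∀ u v → Edge G u v → Fin k
    col-sym : ∀ u v (e : Edge G u v) (e' : Edge G v u) → col u v e ≡ col v u e'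

open EdgeColoring public

record EdgeSet {n} (G : Graph n) : Set where
  field
    mem     : ∀ u v → Edge G u v → Bool
    mem-sym : ∀ u v (e : Edge G u v) (e' : Edge G v u) → mem u v e ≡ mem v u e'

open EdgeSet public

EdgeMinus : ∀ {n} (G : Graph n) → EdgeSet G → Fin n → Fin n → Set
EdgeMinus G F u v = Σ (Edge G u v) λ e → mem F u v e ≡ false

ProperSet : ∀ {n k} {G : Graph n} → EdgeColoring G k → EdgeSet G → Set
ProperSet {G = G} c F =
  ∀ u v w (e₁ : Edge G u v) (e₂ : Edge G u w) → v ≢ w →
  mem F u v e₁ ≡ true → mem F u w e₂ ≡ true → col c u v e₁ ≢ col c u w e₂

Disconnects : ∀ {n} (G : Graph n) → EdgeSet G → Set
Disconnects G F = Σ _ λ x → Σ _ λ y → ¬ Star (EdgeMinus G F) x y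

ProperCut : ∀ {n k} {G : Graph n} → EdgeColoring G k → EdgeSet G → Set
ProperCut {G = G} c F = Disconnects G F × ProperSet c F

Separates : ∀ {n} (G : Graph n) → EdgeSet G → Fin n → Fin n → Set
Separates G F x y = ¬ Star (EdgeMinus G F) x y

ProperDisconnected : ∀ {n k} {G : Graph n} → EdgeColoring G k → Set
ProperDisconnected {G = G} c =
  ∀ x y → x ≢ y → Σ (EdgeSet G) λ F → ProperCut c F × Separates G F x y

PDColorable : ∀ {n} → Graph n → ℕ → Set
PDColorable G k = Σ (EdgeColoring G k) ProperDisconnected

IsPd : ∀ {n} → Graph n → ℕ → Set
IsPd G p = PDColorable G p × (∀ k → PDColorable G k → p ≤ k)

record Subgraph {m n} (H : Graph m) (G : Graph n) : Set where
  field
    emb      : Fin m → Fin n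
    emb-inj  : ∀ u v → emb u ≡ emb v → u ≡ v
    emb-edge : ∀ u v → Edge H u v → Edge G (emb u) (emb v)

module Submission where

open import Defs
open import Data.Nat using (ℕ; _≤_)
open import Data.Product using (_,_)
open import Relation.Binary.PropositionalEquality using (_≢_)
open import Relation.Binary.Construct.Closure.ReflexiveTransitive using (Star; gmap)

-- Let H be a subgraph of G via an injective, edge-preserving
-- vertex map emb.  Any edge-colouring c of G and any edge set F of G restrict
-- along emb to a colouring c|H and an edge set F|H of H.  Two facts make
-- restriction compatible with proper disconnection:
--   * a walk of H - F|H maps to a walk of G - F, so if F separates emb x and
--     emb y in G then F|H separates x and y in H (in particular H - F|H is
--     disconnected);
--   * since emb is injective, two distinct edges of F|H at a common vertex are
--     sent to two distinct edges of F at a common vertex, so F|H is proper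
--     for c|H whenever F is proper for c.
-- Hence a proper-disconnecting k-colouring of G restricts to one of H, and
-- minimality of pd(H) gives pd(H) ≤ pd(G).  Connectivity and |V(H)| ≥ 2 are
-- only needed for pd to be meaningful; the inequality itself does not use them.

module Restriction {m n} {H : Graph m} {G : Graph n} (S : Subgraph H G) where
  open Subgraph S

  restrictColoring : ∀ {k} → EdgeColoring G k → EdgeColoring H k
  restrictColoring c = record
    { col     = λ u v e → col c (emb u) (emb v) (emb-edge u v e)
    ; col-sym = λ u v e e' → col-sym c (emb u) (emb v) (emb-edge u v e) (emb-edge v u e')
    }

  restrictEdgeSet : EdgeSet G → EdgeSet H
  restrictEdgeSet F = record
    { mem     = λ u v e → mem F (emb u) (emb v) (emb-edge u v e)
    ; mem-sym = λ u v e e' → mem-sym F (emb u) (emb v) (emb-edge u v e) (emb-edge v u e')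
    }

  liftWalk : ∀ F {x y} → Star (EdgeMinus H (restrictEdgeSet F)) x y →
             Star (EdgeMinus G F) (emb x) (emb y)
  liftWalk F = gmap emb (λ {u} {v} (e , notInF) → emb-edge u v e , notInF)

  restrictSeparates : ∀ F {x y} → Separates G F (emb x) (emb y) →
                      Separates H (restrictEdgeSet F) x y
  restrictSeparates F sep walkH = sep (liftWalk F walkH)

  emb-≢ : ∀ {u v} → u ≢ v → emb u ≢ emb v
  emb-≢ {u} {v} u≢v eq = u≢v (emb-inj u v eq)

  restrictProper : ∀ {k} (c : EdgeColoring G k) F → ProperSet c F →
                   ProperSet (restrictColoring c) (restrictEdgeSet F)
  restrictProper c F proper u v w e₁ e₂ v≢w =
    proper (emb u) (emb v) (emb w) (emb-edge u v e₁) (emb-edge u w e₂) (emb-≢ v≢w)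

  restrictPDColorable : ∀ {k} → PDColorable G k → PDColorable H k
  restrictPDColorable (c , pdc) = restrictColoring c , separating
    where
    separating : ProperDisconnected (restrictColoring c)
    separating x y x≢y with pdc (emb x) (emb y) (emb-≢ x≢y)
    ... | F , (_ , proper) , sep =
      restrictEdgeSet F ,
      ((x , y , restrictSeparates F sep) , restrictProper c F proper) ,
      restrictSeparates F sep

lemma2p3 : ∀ {m n} (G : Graph n) (H : Graph m) → Subgraph H G →
    Connected G → Connected H → 2 ≤ m →
    ∀ p q → IsPd H p → IsPd G q → p ≤ q
lemma2p3 G H S _ _ _ p q (_ , pMinimal) (pdG , _) =
  pMinimal q (Restriction.restrictPDColorable S pdG)
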